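{- If $j\equiv 38\pmod{48}$, then \[B^{\pm}(j+1)\equiv5,\quad B^{\pm}(j+2)\equiv5,\quad B^{\pm}(j+3)\equiv14,\quad B^{\pm}(j+4)\equiv3,\quad B^{\pm}(j+5)\equiv11\pmod{16}.\]
   Context: $B^{\pm}(n)=\sum_{k=0}^n(-1)^kS(n,k)$ with $S(n,k)$ the Stirling numbers of the second kind. -}

module Defs where

open import Data.Nat as ℕ using (ℕ; zero; suc)
open import Data.Integer as ℤ using (ℤ; +_; -_; _-_)
open import Data.Integer.Divisibility using (_∣_)

S : ℕ → ℕ → ℕ
S zero    zero    = 1
S zero    (suc k) = 0
S (suc n) zero    = 0
S (suc n) (suc k) = suc k ℕ.* S n (suc k) ℕ.+ S n k

sgn : ℕ → ℤ
sgn zero    = + 1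
sgn (suc k) = - sgn k

partialB : ℕ → ℕ → ℤ
partialB n zero    = sgn 0 ℤ.* + S n 0
partialB n (suc m) = partialB n m ℤ.+ sgn (suc m) ℤ.* + S n (suc m)

B± : ℕ → ℤ
B± n = partialB n n

_≡_[mod_] : ℤ → ℤ → ℕ → Set
a ≡ b [mod m ] = (+ m) ∣ (a - b)

-- Let Λₙ f = Σₖ (-1)ᵏ S(n,k) f(k), so that B±(n) = Λₙ 1. The recurrence for S gives
-- Λₙ₊₁ f = Λₙ (D f) with D f (k) = k f(k) − f(k+1), hence B±(n) = (Dⁿ 1)(0). Modulo m,
-- D maps m-periodic functions to m-periodic functions, so it acts on vectors of m residues,
-- and B±(n) mod m is read off the orbit of the all-ones vector. For m = 16 that orbit has
-- period 48, and the five residues are those of the orbit at steps 39, …, 43.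
module Submission where

open import Defs
open import Data.Nat using (ℕ; _+_; _%_)
open import Data.Integer using (+_)
open import Data.Product using (_×_)
open import Relation.Binary.PropositionalEquality using (_≡_)

open import Data.Nat as ℕ using (zero; suc; _<_; NonZero)
open import Data.Nat.DivMod using (_mod_; _/_; m≡m%n+[m/n]*n; m%n%n≡m%n; %-distribˡ-+)
open import Data.Nat.GeneralisedArithmetic using (iterate)
import Data.Nat.Properties as ℕ
open import Data.Integer as ℤ using (ℤ; -_; _-_; _%ℕ_; _/ℕ_)
open import Data.Integer.DivMod using (a≡a%ℕn+[a/ℕn]*n)
open import Data.Integer.Divisibility.Signed as Signed
  using (divides; ∣ᵤ⇒∣; ∣⇒∣ᵤ; ∣m∣n⇒∣m+n; ∣m⇒∣-m; ∣n⇒∣m*n; ∣m⇒∣m*n; ∣m∣n⇒∣m-n)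
open import Data.Integer.Properties using (pos-+; pos-*; *-identityʳ; *-identityˡ)
open import Data.Integer.Tactic.RingSolver using (solve-∀)
open import Data.Fin using (toℕ)
open import Data.Fin.Properties using (toℕ-fromℕ<; fromℕ<-cong)
open import Data.Vec using (Vec; lookup; tabulate; replicate)
open import Data.Vec.Properties using (lookup∘tabulate; lookup-replicate; ≡-dec)
open import Data.Product using (_,_)
open import Relation.Nullary.Decidable using (toWitness)
open import Relation.Binary.PropositionalEquality
  using (refl; sym; trans; cong; cong₂; subst; module ≡-Reasoning)

private
  variable
    a b c a′ b′ : ℤ

-- A record wrapper around the congruence of Defs, so that its two sides can be inferred.
infix 4 _≈_[mod_]
record _≈_[mod_] (a b : ℤ) (m : ℕ) : Set where
  constructor congruent
  field divides-difference : a ≡ b [mod m ]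
open _≈_[mod_] public

module _ {m : ℕ} where

  private
    fromSigned : (+ m) Signed.∣ (a - b) → a ≈ b [mod m ]
    fromSigned m∣a-b = congruent (∣⇒∣ᵤ m∣a-b)

    toSigned : a ≈ b [mod m ] → (+ m) Signed.∣ (a - b)
    toSigned a≈b = ∣ᵤ⇒∣ (divides-difference a≈b)

    self-difference : ∀ a d → a - a ≡ + 0 ℤ.* d
    self-difference = solve-∀

    difference-swap : ∀ a b → - (a - b) ≡ b - a
    difference-swap = solve-∀

    difference-telescope : ∀ a b c → (a - b) ℤ.+ (b - c) ≡ a - c
    difference-telescope = solve-∀

    difference-*ˡ : ∀ k a b → k ℤ.* (a - b) ≡ k ℤ.* a - k ℤ.* b
    difference-*ˡ = solve-∀

    difference-*ʳ : ∀ a b k → (a - b) ℤ.* k ≡ a ℤ.* k - b ℤ.* k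
    difference-*ʳ = solve-∀

    difference-− : ∀ a a′ b b′ → (a - a′) - (b - b′) ≡ (a - b) - (a′ - b′)
    difference-− = solve-∀

    remainder-cancel : ∀ r q d → (r ℤ.+ q ℤ.* d) - r ≡ q ℤ.* d
    remainder-cancel = solve-∀

  ≈-refl : a ≈ a [mod m ]
  ≈-refl {a} = fromSigned (divides (+ 0) (self-difference a (+ m)))

  ≈-reflexive : a ≡ b → a ≈ b [mod m ]
  ≈-reflexive refl = ≈-refl

  ≈-sym : a ≈ b [mod m ] → b ≈ a [mod m ]
  ≈-sym {a} {b} a≈b = fromSigned (subst (_ Signed.∣_) (difference-swap a b) (∣m⇒∣-m (toSigned a≈b)))

  ≈-trans : a ≈ b [mod m ] → b ≈ c [mod m ] → a ≈ c [mod m ]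
  ≈-trans {a} {b} {c} a≈b b≈c =
    fromSigned (subst (_ Signed.∣_) (difference-telescope a b c) (∣m∣n⇒∣m+n (toSigned a≈b) (toSigned b≈c)))

  ≈-*-congˡ : ∀ k → a ≈ b [mod m ] → k ℤ.* a ≈ k ℤ.* b [mod m ]
  ≈-*-congˡ {a} {b} k a≈b = fromSigned (subst (_ Signed.∣_) (difference-*ˡ k a b) (∣n⇒∣m*n k (toSigned a≈b)))

  ≈-*-congʳ : ∀ k → a ≈ b [mod m ] → a ℤ.* k ≈ b ℤ.* k [mod m ]
  ≈-*-congʳ {a} {b} k a≈b = fromSigned (subst (_ Signed.∣_) (difference-*ʳ a b k) (∣m⇒∣m*n k (toSigned a≈b)))

  ≈-−-cong : a ≈ a′ [mod m ] → b ≈ b′ [mod m ] → a - b ≈ a′ - b′ [mod m ]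
  ≈-−-cong {a} {a′} {b} {b′} a≈a′ b≈b′ =
    fromSigned (subst (_ Signed.∣_) (difference-− a a′ b b′) (∣m∣n⇒∣m-n (toSigned a≈a′) (toSigned b≈b′)))

  ≈-%ℕ : .{{_ : NonZero m}} → ∀ a → a ≈ + (a %ℕ m) [mod m ]
  ≈-%ℕ a = fromSigned (divides (a /ℕ m) a-r≡qm)
    where
    a-r≡qm : a - + (a %ℕ m) ≡ (a /ℕ m) ℤ.* + m
    a-r≡qm = trans (cong (_- + (a %ℕ m)) (a≡a%ℕn+[a/ℕn]*n a m)) (remainder-cancel (+ (a %ℕ m)) (a /ℕ m) (+ m))

  ≈-pos : .{{_ : NonZero m}} → ∀ {k l} → k % m ≡ l % m → + k ≈ + l [mod m ]
  ≈-pos {k} {l} k≡l = ≈-trans (≈-%ℕ (+ k)) (subst (λ r → + r ≈ + l [mod m ]) (sym k≡l) (≈-sym (≈-%ℕ (+ l))))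

stirlingSum : ℕ → ℕ → (ℕ → ℤ) → ℤ
stirlingSum n zero    f = sgn 0 ℤ.* + S n 0 ℤ.* f 0
stirlingSum n (suc r) f = stirlingSum n r f ℤ.+ sgn (suc r) ℤ.* + S n (suc r) ℤ.* f (suc r)

partialB≡stirlingSum : ∀ n r → partialB n r ≡ stirlingSum n r (λ _ → + 1)
partialB≡stirlingSum n zero    = sym (*-identityʳ _)
partialB≡stirlingSum n (suc r) = cong₂ ℤ._+_ (partialB≡stirlingSum n r) (sym (*-identityʳ _))

D : (ℕ → ℤ) → ℕ → ℤ
D f k = + k ℤ.* f k - f (suc k)

n<k⇒S[n,k]≡0 : ∀ {n k} → n < k → S n k ≡ 0
n<k⇒S[n,k]≡0 {zero}  {suc k} _ = refl
n<k⇒S[n,k]≡0 {suc n} {suc k} (ℕ.s≤s n<k)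
  rewrite n<k⇒S[n,k]≡0 {n} {suc k} (ℕ.m<n⇒m<1+n n<k) | n<k⇒S[n,k]≡0 n<k
  = trans (ℕ.+-identityʳ (k ℕ.* 0)) (ℕ.*-zeroʳ k)

pos-S-suc : ∀ n k → + S (suc n) (suc k) ≡ + suc k ℤ.* + S n (suc k) ℤ.+ + S n k
pos-S-suc n k = trans (pos-+ (suc k ℕ.* S n (suc k)) (S n k)) (cong (ℤ._+ + S n k) (pos-* (suc k) (S n (suc k))))

-- The sum over k ≤ r+1 of the S(n,k−1) parts is the sum over k ≤ r of the f(k+1) parts of D f,
-- so only the top term k S(n,k) f(k) at k = r+1 is left over.
stirlingSum-suc : ∀ n r f → stirlingSum (suc n) (suc r) f
                 ≡ stirlingSum n r (D f) ℤ.+ sgn (suc r) ℤ.* + S n (suc r) ℤ.* (+ suc r ℤ.* f (suc r))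
stirlingSum-suc n zero f = trans (cong (λ t → + 1 ℤ.* + 0 ℤ.* f 0 ℤ.+ - + 1 ℤ.* t ℤ.* f 1) (pos-S-suc n 0))
                                 (base-identity (+ S n 1) (+ S n 0) (f 0) (f 1))
  where
  base-identity : ∀ a b x y → + 1 ℤ.* + 0 ℤ.* x ℤ.+ - + 1 ℤ.* (+ 1 ℤ.* a ℤ.+ b) ℤ.* y
                            ≡ + 1 ℤ.* b ℤ.* (+ 0 ℤ.* x - y) ℤ.+ - + 1 ℤ.* a ℤ.* (+ 1 ℤ.* y)
  base-identity = solve-∀
stirlingSum-suc n (suc r) f = begin
  stirlingSum (suc n) (suc r) f ℤ.+ - s ℤ.* + S (suc n) (suc (suc r)) ℤ.* f (suc (suc r))
    ≡⟨ cong₂ (λ x y → x ℤ.+ - s ℤ.* y ℤ.* f (suc (suc r))) (stirlingSum-suc n r f) (pos-S-suc n (suc r)) ⟩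
  (stirlingSum n r (D f) ℤ.+ s ℤ.* + S n (suc r) ℤ.* (+ suc r ℤ.* f (suc r)))
    ℤ.+ - s ℤ.* (+ suc (suc r) ℤ.* + S n (suc (suc r)) ℤ.+ + S n (suc r)) ℤ.* f (suc (suc r))
    ≡⟨ step-identity (stirlingSum n r (D f)) s (+ S n (suc (suc r))) (+ S n (suc r)) (+ suc r) (+ suc (suc r)) (f (suc r)) (f (suc (suc r))) ⟩
  stirlingSum n (suc r) (D f) ℤ.+ - s ℤ.* + S n (suc (suc r)) ℤ.* (+ suc (suc r) ℤ.* f (suc (suc r))) ∎
  where
  open ≡-Reasoning
  s : ℤ
  s = sgn (suc r)
  step-identity : ∀ Σ s a b c d x y → (Σ ℤ.+ s ℤ.* b ℤ.* (c ℤ.* x)) ℤ.+ - s ℤ.* (d ℤ.* a ℤ.+ b) ℤ.* y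
                                    ≡ (Σ ℤ.+ s ℤ.* b ℤ.* (c ℤ.* x - y)) ℤ.+ - s ℤ.* a ℤ.* (d ℤ.* y)
  step-identity = solve-∀

stirlingSum-diagonal-suc : ∀ n f → stirlingSum (suc n) (suc n) f ≡ stirlingSum n n (D f)
stirlingSum-diagonal-suc n f =
  trans (stirlingSum-suc n n f)
        (trans (cong (λ t → stirlingSum n n (D f) ℤ.+ sgn (suc n) ℤ.* + t ℤ.* (+ suc n ℤ.* f (suc n)))
                     (n<k⇒S[n,k]≡0 (ℕ.n<1+n n)))
               (vanishing-term (stirlingSum n n (D f)) (sgn (suc n)) (+ suc n ℤ.* f (suc n))))
  where
  vanishing-term : ∀ x s y → x ℤ.+ s ℤ.* + 0 ℤ.* y ≡ x
  vanishing-term = solve-∀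

stirlingSum-diagonal≡iterate-D : ∀ n f → stirlingSum n n f ≡ iterate D f n 0
stirlingSum-diagonal≡iterate-D zero    f = *-identityˡ (f 0)
stirlingSum-diagonal≡iterate-D (suc n) f =
  trans (stirlingSum-diagonal-suc n f) (stirlingSum-diagonal≡iterate-D n (D f))

B±≡iterate-D : ∀ n → B± n ≡ iterate D (λ _ → + 1) n 0
B±≡iterate-D n = trans (partialB≡stirlingSum n n) (stirlingSum-diagonal≡iterate-D n _)

module _ (m : ℕ) .{{_ : NonZero m}} where

  extend : Vec ℕ m → ℕ → ℤ
  extend v k = + lookup v (k mod m)

  Dᵥ : Vec ℕ m → Vec ℕ m
  Dᵥ v = tabulate λ i → D (extend v) (toℕ i) %ℕ m

  ones : Vec ℕ m
  ones = replicate m 1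

  extend-periodic : ∀ v {k l} → k % m ≡ l % m → extend v k ≡ extend v l
  extend-periodic v {k} {l} k≡l = cong (λ i → + lookup v i) (fromℕ<-cong _ _ k≡l _ _)

  %-suc-cong : ∀ {k l} → k % m ≡ l % m → suc k % m ≡ suc l % m
  %-suc-cong {k} {l} k≡l = begin
    (1 + k) % m           ≡⟨ %-distribˡ-+ 1 k m ⟩
    (1 % m + k % m) % m   ≡⟨ cong (λ r → (1 % m + r) % m) k≡l ⟩
    (1 % m + l % m) % m   ≡⟨ %-distribˡ-+ 1 l m ⟨
    (1 + l) % m           ∎
    where open ≡-Reasoning

  D-periodic : ∀ f → (∀ {k l} → k % m ≡ l % m → f k ≡ f l) →
               ∀ {k l} → k % m ≡ l % m → D f k ≈ D f l [mod m ]
  D-periodic f f-periodic {k} {l} k≡l =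
    ≈-−-cong (≈-trans (≈-*-congʳ (f k) (≈-pos k≡l)) (≈-reflexive (cong (+ l ℤ.*_) (f-periodic k≡l))))
             (≈-reflexive (f-periodic (%-suc-cong k≡l)))

  D-cong : ∀ {f g} → (∀ k → f k ≈ g k [mod m ]) → ∀ k → D f k ≈ D g k [mod m ]
  D-cong f≈g k = ≈-−-cong (≈-*-congˡ (+ k) (f≈g k)) (f≈g (suc k))

  D-extend : ∀ v k → D (extend v) k ≈ extend (Dᵥ v) k [mod m ]
  D-extend v k =
    ≈-trans (D-periodic (extend v) (extend-periodic v) k%m≡)
      (≈-trans (≈-%ℕ (D (extend v) (toℕ (k mod m))))
        (≈-reflexive (cong +_ (sym (lookup∘tabulate _ (k mod m))))))
    where
    k%m≡ : k % m ≡ toℕ (k mod m) % m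
    k%m≡ = sym (trans (cong (_% m) (toℕ-fromℕ< _)) (m%n%n≡m%n k m))

  iterate-D-extend : ∀ {f} v → (∀ k → f k ≈ extend v k [mod m ]) →
                     ∀ n k → iterate D f n k ≈ extend (iterate Dᵥ v n) k [mod m ]
  iterate-D-extend v f≈v zero    = f≈v
  iterate-D-extend v f≈v (suc n) =
    iterate-D-extend (Dᵥ v) (λ k → ≈-trans (D-cong f≈v k) (D-extend v k)) n

  B±≈orbit : ∀ n → B± n ≈ extend (iterate Dᵥ ones n) 0 [mod m ]
  B±≈orbit n = ≈-trans (≈-reflexive (B±≡iterate-D n)) (iterate-D-extend ones one≈ones n 0)
    where
    one≈ones : ∀ k → + 1 ≈ extend ones k [mod m ]
    one≈ones k = ≈-reflexive (cong +_ (sym (lookup-replicate (k mod m) 1)))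

iterate-+ : ∀ {A : Set} (f : A → A) x a b → iterate f x (a + b) ≡ iterate f (iterate f x a) b
iterate-+ f x zero    b = refl
iterate-+ f x (suc a) b = iterate-+ f (f x) a b

iterate-periodic : ∀ {A : Set} (f : A → A) x p .{{_ : NonZero p}} → iterate f x p ≡ x →
                   ∀ n → iterate f x n ≡ iterate f x (n % p)
iterate-periodic f x p period n = begin
  iterate f x n                                 ≡⟨ cong (iterate f x) n≡ ⟩
  iterate f x (n / p ℕ.* p + n % p)             ≡⟨ iterate-+ f x (n / p ℕ.* p) (n % p) ⟩
  iterate f (iterate f x (n / p ℕ.* p)) (n % p) ≡⟨ cong (λ y → iterate f y (n % p)) (whole-periods (n / p)) ⟩
  iterate f x (n % p)                           ∎
  where
  open ≡-Reasoning
  n≡ : n ≡ n / p ℕ.* p + n % p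
  n≡ = trans (m≡m%n+[m/n]*n n p) (ℕ.+-comm (n % p) _)
  whole-periods : ∀ q → iterate f x (q ℕ.* p) ≡ x
  whole-periods zero    = refl
  whole-periods (suc q) =
    trans (iterate-+ f x p (q ℕ.* p)) (trans (cong (λ y → iterate f y (q ℕ.* p)) period) (whole-periods q))

orbit16 : ℕ → ℤ
orbit16 r = extend 16 (iterate (Dᵥ 16) (ones 16) r) 0

-- Decided rather than proved by refl: conversion checking would re-evaluate the shared
-- intermediate vectors of the orbit and take exponential time.
orbit16-period : iterate (Dᵥ 16) (ones 16) 48 ≡ ones 16
orbit16-period = toWitness {a? = ≡-dec ℕ._≟_ (iterate (Dᵥ 16) (ones 16) 48) (ones 16)} _

B±-mod16 : ∀ n → B± n ≈ orbit16 (n % 48) [mod 16 ]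
B±-mod16 n = subst (λ v → B± n ≈ extend 16 v 0 [mod 16 ])
                   (iterate-periodic (Dᵥ 16) (ones 16) 48 orbit16-period n) (B±≈orbit 16 n)

lemma7p1 : (j : ℕ) → j % 48 ≡ 38 →
    (B± (j + 1) ≡ + 5 [mod 16 ]) × (B± (j + 2) ≡ + 5 [mod 16 ]) × (B± (j + 3) ≡ + 14 [mod 16 ]) × (B± (j + 4) ≡ + 3 [mod 16 ]) × (B± (j + 5) ≡ + 11 [mod 16 ])
lemma7p1 j j%48≡38 = residue 1 , residue 2 , residue 3 , residue 4 , residue 5
  where
  shift : ∀ i → (j + i) % 48 ≡ (38 + i) % 48
  shift i = trans (%-distribˡ-+ j i 48)
                  (trans (cong (λ r → (r + i % 48) % 48) j%48≡38) (sym (%-distribˡ-+ 38 i 48)))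
  residue : ∀ i → B± (j + i) ≡ orbit16 ((38 + i) % 48) [mod 16 ]
  residue i = divides-difference (subst (λ r → B± (j + i) ≈ orbit16 r [mod 16 ]) (shift i) (B±-mod16 (j + i)))
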